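{- Let $X$ be a finite set with $|X|\ge3$. If $\mathcal D\subseteq\mathfrak C$ is balanced (every $c\in\mathcal D$ is balanced), then every $\bar t\in\mathrm{pr\text{ - }cl}(\mathcal D)$ is balanced, and hence every member of $\mathrm{maj\text{ - }cl}(\mathcal D)$ is pseudo-balanced.
   Context: $\mathfrak C$ is the set of partial choice functions on two-element subsets of $X$ ($c\{x,y\}\in\{x,y\}$ when defined). For $c\in\mathfrak C$ and $x\in X$, $\mathrm{val}_c(x)=|\{y\ne x:c\{x,y\}=y\}|+\tfrac12|\{y\ne x:c\{x,y\}\text{ undefined}\}|$; $c$ is balanced if $\mathrm{val}_c(x)=(|X|-1)/2$ for all $x$. $\mathrm{pr}(\mathfrak C)$ is the set of $\bar t=\langle t_{x,y}:x\ne y\rangle$ with $t_{x,y}\in[0,1]$, $t_{y,x}=1-t_{x,y}$; $\bar t$ is balanced if $\sum_{y\ne x}t_{x,y}=(|X|-1)/2$ for every $x$. $\bar t[d]$ has $t_{x,y}[d]=1,0,\tfrac12$ according as $d\{x,y\}=y$, $=x$, undefined. $\mathrm{pr\text{ - }cl}(\mathcal D)$ is the convex hull of $\{\bar t[d]:d\in\mathcal D\}$; $\mathrm{maj}(\bar t)\{x,y\}=y\iff t_{x,y}>\tfrac12$ (undefined if $t_{x,y}=\tfrac12$); $\mathrm{maj\text{ - }cl}(\mathcal D)=\{\mathrm{maj}(\bar t):\bar t\in\mathrm{pr\text{ - }cl}(\mathcal D)\}$. For $c\in\mathfrak C$, $\mathrm{Tor}[c]$ is the directed graph on $X$ with edges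 $(x,y)$ for $c\{x,y\}=y$; $c$ is pseudo-balanced if every edge of $\mathrm{Tor}[c]$ lies on a directed cycle.
   Formalization: The coordinates $t_{x,y}$ and the convex weights in $\mathrm{pr\text{ - }cl}(\mathcal D)$ are rational rather than real, so $\mathrm{maj\text{ - }cl}(\mathcal D)$ is taken over rational points $\bar t$. -}

module Defs where

open import Data.Nat as ℕ using (ℕ; _∸_)
open import Data.Integer using (+_)
open import Data.Rational using (ℚ; _/_; 0ℚ; 1ℚ; ½; _+_; _*_; _≤_; _<_)
open import Data.Fin using (Fin; _≟_)
open import Data.Fin.Base using ()
open import Data.List using (List; []; _∷_; map; filter; foldr; length; allFin)
open import Data.List.Relation.Unary.All using (All)
open import Data.Maybe using (Maybe; just; nothing)
import Data.Maybe.Properties as MP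
open import Data.Product using (Σ; ∃; _×_; _,_; proj₁)
open import Data.Sum using (_⊎_)
open import Relation.Nullary using (¬_; yes; no)
open import Relation.Nullary.Decidable using (¬?; _×-dec_)
open import Relation.Binary.PropositionalEquality using (_≡_; _≢_)
open import Relation.Binary.Construct.Closure.ReflexiveTransitive using (Star)
open import Data.Rational.Properties using () renaming (_≟_ to _≟ℚ_)
open import Data.Rational using () renaming (_<?_ to _<?ℚ_)

-- X = Fin n.  A partial choice function on two-element subsets of X:
-- ch x y is c{x,y} (nothing = undefined); it is symmetric, takes values
-- in {x,y}, and (by convention) ch x x = nothing.
record ChoiceFn (n : ℕ) : Set where
  field
    ch    : Fin n → Fin n → Maybe (Fin n)
    symm  : ∀ x y → ch x y ≡ ch y x
    valid : ∀ x y z → ch x y ≡ just z → z ≡ x ⊎ z ≡ y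
    diag  : ∀ x → ch x x ≡ nothing
open ChoiceFn public

sumℚ : List ℚ → ℚ
sumℚ = foldr _+_ 0ℚ

others : {n : ℕ} → Fin n → List (Fin n)
others x = filter (λ y → ¬? (y ≟ x)) (allFin _)

half-n-1 : ℕ → ℚ
half-n-1 n = (+ (n ∸ 1)) / 2

val : {n : ℕ} → ChoiceFn n → Fin n → ℚ
val c x =
  ((+ length (filter (λ y → MP.≡-dec _≟_ (ch c x y) (just y)) (others x))) / 1)
  + ½ * ((+ length (filter (λ y → MP.≡-dec _≟_ (ch c x y) nothing) (others x))) / 1)

BalancedC : {n : ℕ} → ChoiceFn n → Set
BalancedC {n} c = ∀ x → val c x ≡ half-n-1 n

BalancedFamily : {n : ℕ} → (ChoiceFn n → Set) → Set
BalancedFamily {n} D = ∀ c → D c → BalancedC c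

-- elements of pr(𝔠) are given as t x y = t_{x,y} (diagonal ignored)
BalancedT : {n : ℕ} → (Fin n → Fin n → ℚ) → Set
BalancedT {n} t = ∀ x → sumℚ (map (t x) (others x)) ≡ half-n-1 n

tbar : {n : ℕ} → ChoiceFn n → Fin n → Fin n → ℚ
tbar d x y with ch d x y
... | nothing = ½
... | just z with z ≟ y
...   | yes _ = 1ℚ
...   | no _  = 0ℚ

InPrCl : {n : ℕ} → (ChoiceFn n → Set) → (Fin n → Fin n → ℚ) → Set
InPrCl {n} D t =
  Σ (List (ℚ × ChoiceFn n)) λ ws →
    All (λ w → 0ℚ ≤ proj₁ w × D (Data.Product.proj₂ w)) ws
    × sumℚ (map proj₁ ws) ≡ 1ℚ
    × (∀ x y → x ≢ y →
         t x y ≡ sumℚ (map (λ w → proj₁ w * tbar (Data.Product.proj₂ w) x y) ws))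

majVal : {n : ℕ} → (Fin n → Fin n → ℚ) → Fin n → Fin n → Maybe (Fin n)
majVal t x y with ½ <?ℚ t x y
... | yes _ = just y
... | no _ with t x y ≟ℚ ½
...   | yes _ = nothing
...   | no _  = just x

InMajCl : {n : ℕ} → (ChoiceFn n → Set) → ChoiceFn n → Set
InMajCl {n} D c =
  Σ (Fin n → Fin n → ℚ) λ t →
    InPrCl D t × (∀ x y → x ≢ y → ch c x y ≡ majVal t x y)

TorEdge : {n : ℕ} → ChoiceFn n → Fin n → Fin n → Set
TorEdge c x y = x ≢ y × ch c x y ≡ just y

-- every edge (x,y) of Tor[c] lies on a directed cycle,
-- i.e. there is a directed path from y back to x
PseudoBalanced : {n : ℕ} → ChoiceFn n → Set
PseudoBalanced c = ∀ x y → TorEdge c x y → Star (TorEdge c) y x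

-- The first claim is linearity: the row sum Σ_{y≠x} t[d]_{x,y} is val_d(x), so a
-- convex combination of balanced rows is balanced.  For the second, let c = maj(t̄)
-- with t̄ ∈ pr-cl(𝒟) and let x → y be an edge of Tor[c], so t_{x,y} > ½.  The excess
-- e_{r,z} = t_{r,z} − ½ (r ≠ z) is antisymmetric, since t_{z,r} = 1 − t_{r,z}, and
-- has zero row sums, since t̄ is balanced; hence its total over any cut (S, X ∖ S)
-- vanishes.  Let S be the set of vertices reachable from y in Tor[c].  No edge of
-- Tor[c] leaves S, so every term of the cut is ≤ 0, which forces all of them to be 0.
-- If x ∉ S this gives t_{y,x} = ½, contradicting t_{y,x} = 1 − t_{x,y} < ½.
module Submission where

open import Defs
open import Data.Nat using (ℕ; _≥_; suc; pred)
open import Data.Fin using (Fin; _≟_)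
open import Data.Fin.Properties using (any?)
open import Data.Fin.Subset using (Subset; _⊃_; _∪_; ⁅_⁆) renaming (_∈_ to _∈ₛ_; _∉_ to _∉ₛ_)
open import Data.Fin.Subset.Properties using (_∈?_; p⊆p∪q; x∈p∪q⁺; x∈p∪q⁻; x∈⁅x⁆; x∈⁅y⁆⇒x≡y)
open import Data.Fin.Subset.Induction using (⊃-wellFounded)
open import Data.Integer as ℤ using (+_)
import Data.Integer.Properties as ℤP
open import Data.Nat.Coprimality using (1-coprimeTo) renaming (sym to coprime-sym)
open import Data.Rational using (ℚ; mkℚ; _/_; 0ℚ; 1ℚ; ½; _+_; _-_; _*_; -_; _≤_; _<_; _<?_)
open import Data.Rational.Properties
  using ( normalize-coprime; /-cong; +-assoc; +-identityˡ; +-identityʳ; neg-distrib-+; *-comm; *-zeroʳ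
        ; *-identityˡ; *-distribˡ-+; ≤-refl; +-mono-≤; +-monoˡ-≤; +-monoˡ-<; +-mono-<-≤; +-mono-≤-<
        ; <-respʳ-≡; <-irrefl; ≮⇒≥ )
  renaming (_≟_ to _≟ℚ_)
open import Data.Rational.Solver using (module +-*-Solver)
open +-*-Solver using (solve; _:=_; _:+_; _:*_; _:-_; :-_; con)
open import Data.List using (List; []; _∷_; filter; length; allFin)
open import Data.List.Properties using (filter-all; length-tabulate)
open import Data.List.Membership.Propositional using (_∈_)
open import Data.List.Membership.Propositional.Properties using (∈-filter⁺; ∈-filter⁻; ∈-allFin)
open import Data.List.Relation.Unary.Any using (here; there)
import Data.List.Relation.Unary.All as All
open import Data.List.Relation.Unary.Unique.Propositional using (Unique; _∷_)
open import Data.List.Relation.Unary.Unique.Propositional.Properties using (allFin⁺)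
open import Data.Maybe using (just; nothing)
open import Data.Maybe.Properties using (just-injective) renaming (≡-dec to ≡-dec-Maybe)
open import Data.Product using (∃-syntax; _×_; _,_; proj₁; proj₂)
open import Data.Sum using (inj₁; inj₂)
open import Data.Empty using (⊥-elim)
open import Function using (id; _∘_; case_of_)
open import Induction.WellFounded using (Acc; acc)
open import Level using (Level)
open import Relation.Binary using (Rel; DecidableEquality) renaming (Decidable to Decidable₂)
open import Relation.Binary.Construct.Closure.ReflexiveTransitive using (Star; ε; _◅_; _◅◅_)
open import Relation.Binary.PropositionalEquality
  using (_≡_; _≢_; refl; sym; trans; cong; cong₂; subst; ≢-sym; module ≡-Reasoning)
open import Relation.Nullary using (¬_; Dec; yes; no; contradiction)
open import Relation.Nullary.Decidable using (¬?; _×-dec_; decidable-stable)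
open import Relation.Unary using (Pred; Decidable)
open import Relation.Unary.Properties using (∁?)

open ≡-Reasoning

private
  variable
    p : Level
    A B : Set
    n : ℕ

/1≡mkℚ : ∀ m → + m / 1 ≡ mkℚ (+ m) 0 (coprime-sym (1-coprimeTo m))
/1≡mkℚ m = normalize-coprime (coprime-sym (1-coprimeTo m))

/1-suc : ∀ m → + suc m / 1 ≡ 1ℚ + + m / 1
/1-suc m = begin
  + suc m / 1               ≡⟨ /-cong (cong (ℤ._+_ (+ 1)) (sym (ℤP.*-identityʳ (+ m)))) refl ⟩
  (+ 1 ℤ.+ + m ℤ.* + 1) / 1 ≡⟨ cong (_+_ 1ℚ) (sym (/1≡mkℚ m)) ⟩
  1ℚ + + m / 1              ∎

/2≡½*/1 : ∀ m → + m / 2 ≡ ½ * (+ m / 1)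
/2≡½*/1 m = begin
  + m / 2           ≡⟨ /-cong (sym (ℤP.*-identityˡ (+ m))) refl ⟩
  (+ 1 ℤ.* + m) / 2 ≡⟨ cong (½ *_) (sym (/1≡mkℚ m)) ⟩
  ½ * (+ m / 1)     ∎

≡-neg⇒≡0 : ∀ {q} → q ≡ - q → q ≡ 0ℚ
≡-neg⇒≡0 {q} q≡-q = begin
  q             ≡⟨ solve 1 (λ a → a := con ½ :* (a :+ a)) refl q ⟩
  ½ * (q + q)   ≡⟨ cong (λ r → ½ * (q + r)) q≡-q ⟩
  ½ * (q + - q) ≡⟨ solve 1 (λ a → con ½ :* (a :+ :- a) := con 0ℚ) refl q ⟩
  0ℚ            ∎

𝟙[_] : {P : Set p} → Dec P → ℚ
𝟙[ yes _ ] = 1ℚ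
𝟙[ no _ ]  = 0ℚ

∑ : List A → (A → ℚ) → ℚ
∑ xs f = sumℚ (Data.List.map f xs)

infixl 10 ∑
syntax ∑ xs (λ a → e) = ∑[ a ∈ xs ] e

∑-cong : ∀ (xs : List A) {f g : A → ℚ} → (∀ {a} → a ∈ xs → f a ≡ g a) → ∑ xs f ≡ ∑ xs g
∑-cong []       _   = refl
∑-cong (x ∷ xs) f≡g = cong₂ _+_ (f≡g (here refl)) (∑-cong xs (f≡g ∘ there))

∑-zero : ∀ (xs : List A) → ∑[ _ ∈ xs ] 0ℚ ≡ 0ℚ
∑-zero []       = refl
∑-zero (x ∷ xs) = trans (+-identityˡ _) (∑-zero xs)

∑-distrib-+ : ∀ (xs : List A) (f g : A → ℚ) → ∑[ a ∈ xs ] (f a + g a) ≡ ∑ xs f + ∑ xs g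
∑-distrib-+ []       f g = refl
∑-distrib-+ (x ∷ xs) f g = begin
  f x + g x + ∑[ a ∈ xs ] (f a + g a) ≡⟨ cong (_+_ (f x + g x)) (∑-distrib-+ xs f g) ⟩
  f x + g x + (∑ xs f + ∑ xs g)       ≡⟨ solve 4 (λ a b c d → a :+ b :+ (c :+ d) := a :+ c :+ (b :+ d))
                                                 refl (f x) (g x) (∑ xs f) (∑ xs g) ⟩
  f x + ∑ xs f + (g x + ∑ xs g)       ∎

∑-neg : ∀ (xs : List A) (f : A → ℚ) → ∑[ a ∈ xs ] (- f a) ≡ - ∑ xs f
∑-neg []       f = refl
∑-neg (x ∷ xs) f = trans (cong (_+_ (- f x)) (∑-neg xs f)) (sym (neg-distrib-+ (f x) (∑ xs f)))

∑-*ˡ : ∀ (xs : List A) (q : ℚ) (f : A → ℚ) → ∑[ a ∈ xs ] (q * f a) ≡ q * ∑ xs f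
∑-*ˡ []       q f = sym (*-zeroʳ q)
∑-*ˡ (x ∷ xs) q f = trans (cong (_+_ (q * f x)) (∑-*ˡ xs q f)) (sym (*-distribˡ-+ q (f x) (∑ xs f)))

∑-*ʳ : ∀ (xs : List A) (q : ℚ) (f : A → ℚ) → ∑[ a ∈ xs ] (f a * q) ≡ ∑ xs f * q
∑-*ʳ xs q f = begin
  ∑[ a ∈ xs ] (f a * q) ≡⟨ ∑-cong xs (λ {a} _ → *-comm (f a) q) ⟩
  ∑[ a ∈ xs ] (q * f a) ≡⟨ ∑-*ˡ xs q f ⟩
  q * ∑ xs f            ≡⟨ *-comm q (∑ xs f) ⟩
  ∑ xs f * q            ∎

∑-const : ∀ (xs : List A) (q : ℚ) → ∑[ _ ∈ xs ] q ≡ q * (+ length xs / 1)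
∑-const []       q = sym (*-zeroʳ q)
∑-const (x ∷ xs) q = begin
  q + ∑[ _ ∈ xs ] q              ≡⟨ cong (_+_ q) (∑-const xs q) ⟩
  q + q * (+ length xs / 1)       ≡⟨ solve 2 (λ a l → a :+ a :* l := a :* (con 1ℚ :+ l)) refl q _ ⟩
  q * (1ℚ + + length xs / 1)      ≡⟨ cong (q *_) (sym (/1-suc (length xs))) ⟩
  q * (+ length (x ∷ xs) / 1)     ∎

∑-𝟙 : ∀ {P : Pred A p} (P? : Decidable P) (xs : List A) →
      ∑[ a ∈ xs ] 𝟙[ P? a ] ≡ + length (filter P? xs) / 1
∑-𝟙 P? []       = refl
∑-𝟙 P? (x ∷ xs) with P? x
... | yes _ = trans (cong (_+_ 1ℚ) (∑-𝟙 P? xs)) (sym (/1-suc (length (filter P? xs))))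
... | no  _ = trans (+-identityˡ _) (∑-𝟙 P? xs)

∑-partition : ∀ {P : Pred A p} (P? : Decidable P) (xs : List A) (f : A → ℚ) →
              ∑ xs f ≡ ∑ (filter P? xs) f + ∑ (filter (∁? P?) xs) f
∑-partition P? []       f = refl
∑-partition P? (x ∷ xs) f with P? x
... | yes _ = trans (cong (_+_ (f x)) (∑-partition P? xs f)) (sym (+-assoc (f x) _ _))
... | no  _ = trans (cong (_+_ (f x)) (∑-partition P? xs f))
                    (solve 3 (λ a b c → a :+ (b :+ c) := b :+ (a :+ c))
                           refl (f x) (∑ (filter P? xs) f) (∑ (filter (∁? P?) xs) f))

∑-filter : ∀ {P : Pred A p} (P? : Decidable P) (xs : List A) {f : A → ℚ} →
           (∀ {a} → ¬ P a → f a ≡ 0ℚ) → ∑ (filter P? xs) f ≡ ∑ xs f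
∑-filter P? xs {f} f≡0 = sym (begin
  ∑ xs f                                       ≡⟨ ∑-partition P? xs f ⟩
  ∑ (filter P? xs) f + ∑ (filter (∁? P?) xs) f ≡⟨ cong (_+_ (∑ (filter P? xs) f)) rejected≡0 ⟩
  ∑ (filter P? xs) f + 0ℚ                      ≡⟨ +-identityʳ _ ⟩
  ∑ (filter P? xs) f                           ∎)
  where
  rejected≡0 : ∑ (filter (∁? P?) xs) f ≡ 0ℚ
  rejected≡0 = trans (∑-cong (filter (∁? P?) xs) (f≡0 ∘ proj₂ ∘ ∈-filter⁻ (∁? P?) {xs = xs}))
                     (∑-zero (filter (∁? P?) xs))

∑-nonPositive : ∀ {xs : List A} {f : A → ℚ} → (∀ {a} → a ∈ xs → f a ≤ 0ℚ) → ∑ xs f ≤ 0ℚ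
∑-nonPositive {xs = []}     _   = ≤-refl
∑-nonPositive {xs = x ∷ xs} f≤0 = +-mono-≤ (f≤0 (here refl)) (∑-nonPositive (f≤0 ∘ there))

∑-negative : ∀ {xs : List A} {f : A → ℚ} → (∀ {a} → a ∈ xs → f a ≤ 0ℚ) →
             ∀ {a} → a ∈ xs → f a < 0ℚ → ∑ xs f < 0ℚ
∑-negative f≤0 (here refl) fa<0 = +-mono-<-≤ fa<0 (∑-nonPositive (f≤0 ∘ there))
∑-negative f≤0 (there a∈) fa<0  = +-mono-≤-< (f≤0 (here refl)) (∑-negative (f≤0 ∘ there) a∈ fa<0)

∑-comm : ∀ (xs : List A) (ys : List B) (f : A → B → ℚ) →
         ∑[ a ∈ xs ] ∑ ys (f a) ≡ ∑[ b ∈ ys ] ∑[ a ∈ xs ] f a b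
∑-comm []       ys f = sym (∑-zero ys)
∑-comm (x ∷ xs) ys f = trans (cong (_+_ (∑ ys (f x))) (∑-comm xs ys f)) (sym (∑-distrib-+ ys (f x) _))

∑-antisym : ∀ (xs : List A) (f : A → A → ℚ) → (∀ a b → f b a ≡ - f a b) →
            ∑[ a ∈ xs ] ∑ xs (f a) ≡ 0ℚ
∑-antisym xs f antisym = ≡-neg⇒≡0 (begin
  ∑[ a ∈ xs ] ∑ xs (f a)           ≡⟨ ∑-comm xs xs f ⟩
  ∑[ b ∈ xs ] ∑[ a ∈ xs ] f a b    ≡⟨ ∑-cong xs (λ {b} _ → ∑-cong xs (λ {a} _ → antisym b a)) ⟩
  ∑[ b ∈ xs ] ∑[ a ∈ xs ] (- f b a)  ≡⟨ ∑-cong xs (λ {b} _ → ∑-neg xs (f b)) ⟩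
  ∑[ b ∈ xs ] (- ∑ xs (f b))         ≡⟨ ∑-neg xs _ ⟩
  - ∑[ a ∈ xs ] ∑ xs (f a)         ∎)

circulation-∑-cut≡0 : ∀ (xs : List A) (v : A → A → ℚ) → (∀ a b → v b a ≡ - v a b) →
                    (∀ a → ∑ xs (v a) ≡ 0ℚ) →
                    ∀ {P : Pred A p} (P? : Decidable P) →
                    ∑[ a ∈ filter P? xs ] ∑ (filter (∁? P?) xs) (v a) ≡ 0ℚ
circulation-∑-cut≡0 {A = A} xs v antisym rows P? = begin
  cut                ≡⟨ sym (+-identityˡ cut) ⟩
  0ℚ + cut           ≡⟨ cong (_+ cut) (sym (∑-antisym S v antisym)) ⟩
  ∑[ a ∈ S ] ∑ S (v a) + cut
                     ≡⟨ sym (∑-distrib-+ S _ _) ⟩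
  ∑[ a ∈ S ] (∑ S (v a) + ∑ (filter (∁? P?) xs) (v a))
                     ≡⟨ ∑-cong S (λ {a} _ → sym (∑-partition P? xs (v a))) ⟩
  ∑[ a ∈ S ] ∑ xs (v a)
                     ≡⟨ ∑-cong S (λ {a} _ → rows a) ⟩
  ∑[ _ ∈ S ] 0ℚ      ≡⟨ ∑-zero S ⟩
  0ℚ                 ∎
  where
  S : List A
  S = filter P? xs

  cut : ℚ
  cut = ∑[ a ∈ S ] ∑ (filter (∁? P?) xs) (v a)

∑-convex : ∀ (ws : List (ℚ × B)) → ∑ ws proj₁ ≡ 1ℚ → ∀ {g : ℚ × B → ℚ} {k} →
           (∀ {w} → w ∈ ws → g w ≡ k) → ∑[ w ∈ ws ] (proj₁ w * g w) ≡ k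
∑-convex ws ∑λ≡1 {g} {k} g≡k = begin
  ∑[ w ∈ ws ] (proj₁ w * g w) ≡⟨ ∑-cong ws (λ {w} w∈ → cong (proj₁ w *_) (g≡k w∈)) ⟩
  ∑[ w ∈ ws ] (proj₁ w * k)   ≡⟨ ∑-*ʳ ws k proj₁ ⟩
  ∑ ws proj₁ * k              ≡⟨ cong (_* k) ∑λ≡1 ⟩
  1ℚ * k                      ≡⟨ *-identityˡ k ⟩
  k                           ∎

length-filter-≢ : (_≟ₐ_ : DecidableEquality A) {x : A} {xs : List A} → Unique xs → x ∈ xs →
                  length (filter (λ y → ¬? (y ≟ₐ x)) xs) ≡ pred (length xs)
length-filter-≢ _≟ₐ_ {x} {_ ∷ ys} (x∉ys ∷ _) (here refl) with x ≟ₐ x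
... | yes _   = cong length (filter-all (λ y → ¬? (y ≟ₐ x)) (All.map (_∘ sym) x∉ys))
... | no x≢x  = contradiction refl x≢x
length-filter-≢ _≟ₐ_ {x} {y ∷ []} _ (there ())
length-filter-≢ _≟ₐ_ {x} {y ∷ z ∷ zs} (y∉ys ∷ unique) (there x∈ys) with y ≟ₐ x
... | yes refl = contradiction refl (All.lookup y∉ys x∈ys)
... | no  _    = cong suc (length-filter-≢ _≟ₐ_ unique x∈ys)

length-others : (x : Fin n) → length (others x) ≡ pred n
length-others {n} x =
  trans (length-filter-≢ _≟_ (allFin⁺ n) (∈-allFin x)) (cong pred (length-tabulate {n = n} id))

∈-others⁻ : ∀ {x y : Fin n} → y ∈ others x → y ≢ x
∈-others⁻ {n} {x} = proj₂ ∘ ∈-filter⁻ (λ y → ¬? (y ≟ x)) {xs = allFin n}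

ClosedUnder : ∀ {ℓ} → Rel (Fin n) ℓ → Subset n → Set ℓ
ClosedUnder E S = ∀ {r z} → r ∈ₛ S → E r z → z ∈ₛ S

module _ {ℓ} {E : Rel (Fin n) ℓ} (E? : Decidable₂ E) (y : Fin n) where

  ReachableSet : Subset n → Set ℓ
  ReachableSet S = y ∈ₛ S × (∀ {s} → s ∈ₛ S → Star E y s) × ClosedUnder E S

  reachable-set : ∃[ S ] ReachableSet S
  reachable-set = grow ⁅ y ⁆ (⊃-wellFounded ⁅ y ⁆) (x∈⁅x⁆ y)
                       (λ s∈⁅y⁆ → subst (Star E y) (sym (x∈⁅y⁆⇒x≡y y s∈⁅y⁆)) ε)
    where
    grow : ∀ S → Acc _⊃_ S → y ∈ₛ S → (∀ {s} → s ∈ₛ S → Star E y s) → ∃[ S ] ReachableSet S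
    grow S (acc smaller) y∈S reach
      with any? (λ r → any? (λ z → r ∈? S ×-dec ∁? (_∈? S) z ×-dec E? r z))
    ... | no ∄edge = S , y∈S , reach , closed
      where
      closed : ClosedUnder E S
      closed {r} {z} r∈S e = decidable-stable (z ∈? S) (λ z∉S → ∄edge (r , z , r∈S , z∉S , e))
    ... | yes (r , z , r∈S , z∉S , e) =
      grow (S ∪ ⁅ z ⁆) (smaller (p⊆p∪q ⁅ z ⁆ , z , x∈p∪q⁺ (inj₂ (x∈⁅x⁆ z)) , z∉S))
           (p⊆p∪q ⁅ z ⁆ y∈S) reach′
      where
      reach′ : ∀ {s} → s ∈ₛ S ∪ ⁅ z ⁆ → Star E y s
      reach′ {s} s∈ with x∈p∪q⁻ S ⁅ z ⁆ s∈
      ... | inj₁ s∈S = reach s∈S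
      ... | inj₂ s∈⁅z⁆ rewrite x∈⁅y⁆⇒x≡y z s∈⁅z⁆ = reach r∈S ◅◅ e ◅ ε

module _ (d : ChoiceFn n) where

  tbar≡𝟙 : ∀ x y → tbar d x y ≡ 𝟙[ ≡-dec-Maybe _≟_ (ch d x y) (just y) ]
                                + ½ * 𝟙[ ≡-dec-Maybe _≟_ (ch d x y) nothing ]
  tbar≡𝟙 x y with ch d x y
  ... | nothing = refl
  ... | just z with z ≟ y
  ...   | yes refl = refl
  ...   | no  _    = refl

  ∑-tbar≡val : ∀ x → ∑ (others x) (tbar d x) ≡ val d x
  ∑-tbar≡val x = begin
    ∑ (others x) (tbar d x)
      ≡⟨ ∑-cong (others x) (λ {y} _ → tbar≡𝟙 x y) ⟩
    ∑[ y ∈ others x ] (𝟙[ picks? y ] + ½ * 𝟙[ undefined? y ])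
      ≡⟨ ∑-distrib-+ (others x) _ _ ⟩
    ∑[ y ∈ others x ] 𝟙[ picks? y ] + ∑[ y ∈ others x ] (½ * 𝟙[ undefined? y ])
      ≡⟨ cong (_+_ (∑[ y ∈ others x ] 𝟙[ picks? y ])) (∑-*ˡ (others x) ½ _) ⟩
    ∑[ y ∈ others x ] 𝟙[ picks? y ] + ½ * ∑[ y ∈ others x ] 𝟙[ undefined? y ]
      ≡⟨ cong₂ (λ a b → a + ½ * b) (∑-𝟙 picks? (others x)) (∑-𝟙 undefined? (others x)) ⟩
    val d x ∎
    where
    picks? : Decidable (λ y → ch d x y ≡ just y)
    picks? y = ≡-dec-Maybe _≟_ (ch d x y) (just y)

    undefined? : Decidable (λ y → ch d x y ≡ nothing)
    undefined? y = ≡-dec-Maybe _≟_ (ch d x y) nothing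

  tbar-complement : ∀ {x y} → x ≢ y → tbar d x y + tbar d y x ≡ 1ℚ
  tbar-complement {x} {y} x≢y with ch d x y | ch d y x | symm d x y | valid d x y
  ... | nothing | .nothing  | refl | _ = refl
  ... | just z  | .(just z) | refl | valid-xy with valid-xy z refl | z ≟ x | z ≟ y
  ...   | inj₁ refl | yes _   | no _    = refl
  ...   | inj₂ refl | no _    | yes _   = refl
  ...   | inj₁ refl | no z≢z  | _       = contradiction refl z≢z
  ...   | inj₁ refl | _       | yes x≡y = contradiction x≡y x≢y
  ...   | inj₂ refl | yes y≡x | _       = contradiction (sym y≡x) x≢y
  ...   | inj₂ refl | _       | no z≢z  = contradiction refl z≢z

Complementary : (Fin n → Fin n → ℚ) → Set
Complementary t = ∀ {x y} → x ≢ y → t x y + t y x ≡ 1ℚ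

module _ {D : ChoiceFn n → Set} {t : Fin n → Fin n → ℚ} where

  prCl-complementary : InPrCl D t → Complementary t
  prCl-complementary (ws , _ , ∑λ≡1 , t≡) {x} {y} x≢y = begin
    t x y + t y x
      ≡⟨ cong₂ _+_ (t≡ x y x≢y) (t≡ y x (≢-sym x≢y)) ⟩
    ∑[ w ∈ ws ] (proj₁ w * tbar (proj₂ w) x y) + ∑[ w ∈ ws ] (proj₁ w * tbar (proj₂ w) y x)
      ≡⟨ sym (∑-distrib-+ ws _ _) ⟩
    ∑[ w ∈ ws ] (proj₁ w * tbar (proj₂ w) x y + proj₁ w * tbar (proj₂ w) y x)
      ≡⟨ ∑-cong ws (λ {w} _ → sym (*-distribˡ-+ (proj₁ w) _ _)) ⟩
    ∑[ w ∈ ws ] (proj₁ w * (tbar (proj₂ w) x y + tbar (proj₂ w) y x))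
      ≡⟨ ∑-convex ws ∑λ≡1 (λ {w} _ → tbar-complement (proj₂ w) x≢y) ⟩
    1ℚ ∎

  prCl-balanced : BalancedFamily D → InPrCl D t → BalancedT t
  prCl-balanced balanced (ws , ws∈D , ∑λ≡1 , t≡) x = begin
    ∑ (others x) (t x)
      ≡⟨ ∑-cong (others x) (λ y∈ → t≡ x _ (≢-sym (∈-others⁻ y∈))) ⟩
    ∑[ y ∈ others x ] ∑[ w ∈ ws ] (proj₁ w * tbar (proj₂ w) x y)
      ≡⟨ ∑-comm (others x) ws _ ⟩
    ∑[ w ∈ ws ] ∑[ y ∈ others x ] (proj₁ w * tbar (proj₂ w) x y)
      ≡⟨ ∑-cong ws (λ {w} _ → ∑-*ˡ (others x) (proj₁ w) (tbar (proj₂ w) x)) ⟩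
    ∑[ w ∈ ws ] (proj₁ w * ∑ (others x) (tbar (proj₂ w) x))
      ≡⟨ ∑-convex ws ∑λ≡1 (λ {w} w∈ →
           trans (∑-tbar≡val (proj₂ w) x) (balanced (proj₂ w) (proj₂ (All.lookup ws∈D w∈)) x)) ⟩
    half-n-1 n ∎

module _ {t : Fin n → Fin n → ℚ} {x y : Fin n} where

  ½<⇒majVal≡just : ½ < t x y → majVal t x y ≡ just y
  ½<⇒majVal≡just ½<t with ½ <? t x y
  ... | yes _   = refl
  ... | no ½≮t  = contradiction ½<t ½≮t

  majVal≡just⇒½< : x ≢ y → majVal t x y ≡ just y → ½ < t x y
  majVal≡just⇒½< x≢y maj≡y with ½ <? t x y
  ... | yes ½<t = ½<t
  ... | no _ with t x y ≟ℚ ½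
  ...   | yes _ = case maj≡y of λ ()
  ...   | no _  = contradiction (just-injective maj≡y) x≢y

-- The diagonal of t̄ carries no information, so the excess is set to 0 there; this keeps it antisymmetric.
excess : (Fin n → Fin n → ℚ) → Fin n → Fin n → ℚ
excess t r z with z ≟ r
... | yes _ = 0ℚ
... | no _  = t r z - ½

module _ {t : Fin n → Fin n → ℚ} where

  excess-≢ : ∀ {r z} → z ≢ r → excess t r z ≡ t r z - ½
  excess-≢ {r} {z} z≢r with z ≟ r
  ... | yes z≡r = contradiction z≡r z≢r
  ... | no _    = refl

  excess-antisym : Complementary t → ∀ r z → excess t z r ≡ - excess t r z
  excess-antisym complementary r z with z ≟ r | r ≟ z
  ... | yes _   | yes _   = refl
  ... | yes z≡r | no r≢z  = contradiction (sym z≡r) r≢z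
  ... | no z≢r  | yes r≡z = contradiction (sym r≡z) z≢r
  ... | no z≢r  | no _    = begin
    t z r - ½                 ≡⟨ cong (_- ½) (solve 2 (λ a b → b := a :+ b :- a) refl (t r z) (t z r)) ⟩
    t r z + t z r - t r z - ½ ≡⟨ cong (λ s → s - t r z - ½) (complementary (≢-sym z≢r)) ⟩
    1ℚ - t r z - ½            ≡⟨ solve 1 (λ a → con 1ℚ :- a :- con ½ := :- (a :- con ½)) refl (t r z) ⟩
    - (t r z - ½)             ∎

  excess-rowSum : BalancedT t → ∀ r → ∑ (allFin n) (excess t r) ≡ 0ℚ
  excess-rowSum balanced r = begin
    ∑ (allFin n) (excess t r)
      ≡⟨ sym (∑-filter (λ z → ¬? (z ≟ r)) (allFin n) excess-diag) ⟩
    ∑[ z ∈ others r ] excess t r z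
      ≡⟨ ∑-cong (others r) (excess-≢ ∘ ∈-others⁻) ⟩
    ∑[ z ∈ others r ] (t r z + - ½)
      ≡⟨ ∑-distrib-+ (others r) (t r) (λ _ → - ½) ⟩
    ∑ (others r) (t r) + ∑[ _ ∈ others r ] (- ½)
      ≡⟨ cong₂ _+_ (balanced r) (∑-const (others r) (- ½)) ⟩
    + pred n / 2 + - ½ * (+ length (others r) / 1)
      ≡⟨ cong₂ (λ a b → a + - ½ * (+ b / 1)) (/2≡½*/1 (pred n)) (length-others r) ⟩
    ½ * (+ pred n / 1) + - ½ * (+ pred n / 1)
      ≡⟨ solve 1 (λ a → con ½ :* a :+ con (- ½) :* a := con 0ℚ) refl (+ pred n / 1) ⟩
    0ℚ ∎
    where
    excess-diag : ∀ {z} → ¬ (z ≢ r) → excess t r z ≡ 0ℚ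
    excess-diag {z} ¬z≢r with z ≟ r
    ... | yes _   = refl
    ... | no z≢r  = contradiction z≢r ¬z≢r

  cut≤½⇒½≤cut : Complementary t → BalancedT t → (S : Subset n) →
                 (∀ {r z} → r ∈ₛ S → z ∉ₛ S → t r z ≤ ½) →
                 ∀ {r z} → r ∈ₛ S → z ∉ₛ S → ½ ≤ t r z
  cut≤½⇒½≤cut complementary balanced S cut≤½ {r} {z} r∈S z∉S =
    ≮⇒≥ λ trz<½ → <-irrefl cut≡0 (cut<0 trz<½)
    where
    inside outside : List (Fin n)
    inside  = filter (_∈? S) (allFin n)
    outside = filter (∁? (_∈? S)) (allFin n)

    cut≡0 : ∑[ a ∈ inside ] ∑ outside (excess t a) ≡ 0ℚ
    cut≡0 = circulation-∑-cut≡0 (allFin n) (excess t) (excess-antisym complementary)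
                                (excess-rowSum balanced) (_∈? S)

    excess-across : ∀ {a b} → a ∈ₛ S → b ∉ₛ S → excess t a b ≡ t a b - ½
    excess-across a∈S b∉S = excess-≢ (λ { refl → b∉S a∈S })

    excess-across≤0 : ∀ {a} → a ∈ₛ S → ∀ {b} → b ∈ outside → excess t a b ≤ 0ℚ
    excess-across≤0 a∈S {b} b∈ =
      subst (_≤ 0ℚ) (sym (excess-across a∈S b∉S)) (+-monoˡ-≤ (- ½) (cut≤½ a∈S b∉S))
      where
      b∉S : b ∉ₛ S
      b∉S = proj₂ (∈-filter⁻ (∁? (_∈? S)) {xs = allFin n} b∈)

    cut<0 : t r z < ½ → ∑[ a ∈ inside ] ∑ outside (excess t a) < 0ℚ
    cut<0 trz<½ =
      ∑-negative (∑-nonPositive ∘ excess-across≤0 ∘ proj₂ ∘ ∈-filter⁻ (_∈? S) {xs = allFin n})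
                 (∈-filter⁺ (_∈? S) (∈-allFin r) r∈S)
        (∑-negative (excess-across≤0 r∈S) (∈-filter⁺ (∁? (_∈? S)) (∈-allFin z) z∉S)
          (subst (_< 0ℚ) (sym (excess-across r∈S z∉S)) (+-monoˡ-< (- ½) trz<½)))

torEdge? : (c : ChoiceFn n) → Decidable₂ (TorEdge c)
torEdge? c x y = ¬? (x ≟ y) ×-dec ≡-dec-Maybe _≟_ (ch c x y) (just y)

maj-pseudoBalanced : ∀ {t : Fin n → Fin n → ℚ} → Complementary t → BalancedT t →
                     (c : ChoiceFn n) → (∀ x y → x ≢ y → ch c x y ≡ majVal t x y) → PseudoBalanced c
maj-pseudoBalanced {t = t} complementary balanced c c≡maj x y (x≢y , cxy≡y)
  with reachable-set (torEdge? c) y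
... | S , y∈S , reach , closed with x ∈? S
...   | yes x∈S = reach x∈S
...   | no x∉S  = ⊥-elim (<-irrefl refl (<-respʳ-≡ (complementary x≢y) (+-mono-<-≤ ½<txy ½≤tyx)))
  where
  ½<txy : ½ < t x y
  ½<txy = majVal≡just⇒½< {t = t} x≢y (trans (sym (c≡maj x y x≢y)) cxy≡y)

  cut≤½ : ∀ {r z} → r ∈ₛ S → z ∉ₛ S → t r z ≤ ½
  cut≤½ {r} {z} r∈S z∉S = ≮⇒≥ λ ½<trz →
    z∉S (closed r∈S (r≢z , trans (c≡maj r z r≢z) (½<⇒majVal≡just {t = t} ½<trz)))
    where
    r≢z : r ≢ z
    r≢z refl = z∉S r∈S

  ½≤tyx : ½ ≤ t y x
  ½≤tyx = cut≤½⇒½≤cut complementary balanced S cut≤½ y∈S x∉S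

fact3p2 : (n : ℕ) → n ≥ 3 → (D : ChoiceFn n → Set) → BalancedFamily D →
    ((t : Fin n → Fin n → ℚ) → InPrCl D t → BalancedT t)
    × ((c : ChoiceFn n) → InMajCl D c → PseudoBalanced c)
fact3p2 n _ D balanced =
    (λ t → prCl-balanced balanced)
  , λ { c (t , t∈prCl , c≡maj) →
          maj-pseudoBalanced (prCl-complementary t∈prCl) (prCl-balanced balanced t∈prCl) c c≡maj }
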